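{- Let $r$ and $a$ be odd positive integers with $a \ge 3$. Let $d$, $s$ and $x$ be positive integers such that $\frac{d+s}{r+a} = x = \frac{d}{r}$ and $x \ge 2$. Then there exists a simple $(d,d+s)$-graph which has no $(r,r+a)$-factorization with $x$ factors.
   Context: All graphs are finite simple graphs. A $(d,d+s)$-graph is a graph all of whose vertex degrees lie in $\{d, \ldots, d+s\}$. An $(r,r+a)$-factor of $G$ is a spanning subgraph all of whose degrees lie in $\{r,\ldots,r+a\}$; an $(r,r+a)$-factorization of $G$ with $x$ factors is a decomposition of $E(G)$ into $x$ edge-disjoint $(r,r+a)$-factors. -}

module Defs where

open import Data.Nat using (ℕ; _+_; _≤_)
open import Data.Bool using (Bool; true; false)
import Data.Bool.Properties as BoolP
open import Data.Fin using (Fin)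
import Data.Fin.Properties as FinP
open import Data.List using (length; filter; allFin)
open import Data.Product using (_×_)
open import Relation.Binary.PropositionalEquality using (_≡_)
open import Relation.Nullary.Decidable using (_×-dec_)

record Graph (n : ℕ) : Set where
  field
    adj    : Fin n → Fin n → Bool
    sym    : ∀ u v → adj u v ≡ adj v u
    irrefl : ∀ v → adj v v ≡ false
open Graph public

degree : ∀ {n} → Graph n → Fin n → ℕ
degree {n} G v = length (filter (λ w → adj G v w BoolP.≟ true) (allFin n))

IsDDSGraph : ∀ {n} → Graph n → ℕ → ℕ → Set
IsDDSGraph {n} G d s = ∀ (v : Fin n) → d ≤ degree G v × degree G v ≤ d + s

-- A decomposition of E(G) into x edge-disjoint spanning subgraphs
-- F_0, ..., F_{x-1}: each edge uv gets a colour (factor index) col u v,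
-- consistently for both orientations.
record Decomposition {n} (G : Graph n) (x : ℕ) : Set where
  field
    col     : Fin n → Fin n → Fin x
    col-sym : ∀ u v → adj G u v ≡ true → col u v ≡ col v u
open Decomposition public

factorDegree : ∀ {n x} {G : Graph n} → Decomposition G x → Fin x → Fin n → ℕ
factorDegree {n} {x} {G} D i v =
  length (filter (λ w → (adj G v w BoolP.≟ true) ×-dec (col D v w FinP.≟ i)) (allFin n))

IsFactorization : ∀ {n} (G : Graph n) (r a x : ℕ) → Decomposition G x → Set
IsFactorization {n} G r a x D =
  ∀ (i : Fin x) (v : Fin n) → r ≤ factorDegree D i v × factorDegree D i v ≤ r + a

HasFactorization : ∀ {n} (G : Graph n) (r a x : ℕ) → Set
HasFactorization G r a x = Σ' (Decomposition G x) (IsFactorization G r a x)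
  where open import Data.Product using () renaming (Σ to Σ')

Odd : ℕ → Set
Odd n = Σ' ℕ (λ k → n ≡ 2 * k + 1)
  where open import Data.Product using () renaming (Σ to Σ')
        open import Data.Nat using (_*_)

-- In an (r, r+a)-factorization with x factors, a vertex of degree x·r has degree exactly r in every
-- factor, a vertex of degree x·(r+a) has degree exactly r+a in every factor, and a vertex of degree
-- x·(r+a) − 1 still has degree r+a in one of any two factors. So if an odd number of vertices have
-- degree x·r and all others degree x·(r+a), except possibly one of degree x·(r+a) − 1, then some
-- factor has the odd degree r on an odd set of vertices and the even degree r+a elsewhere: its degree
-- sum is odd, contradicting the handshake lemma. Such a graph is the join of the complement of a graph
-- H on x·r vertices with an independent set of odd size. For x even H is empty; for x odd, where
-- parity forces the defective vertex, H is a path on three vertices plus a perfect matching.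
module Submission where

open import Defs
open import Data.Nat using (ℕ; zero; suc; _+_; _*_; _≤_; _<_; z≤n; s≤s)
open import Data.Nat.Divisibility
  using (_∣_; divides; _∣0; ∣1⇒≡1; ∣m+n∣m⇒∣n; ∣m∣n⇒∣m+n; m∣m*n; ∣m⇒∣m*n)
open import Data.Nat.Tactic.RingSolver using (solve-∀)
open import Data.Product using (Σ; _×_; _,_; proj₁; proj₂)
open import Data.Nat.Properties hiding (_≟_)
open import Algebra.Properties.CommutativeMonoid.Sum +-0-commutativeMonoid
  using (sum; sum-syntax; sum-cong-≗; sum-remove; ∑-distrib-+; ∑-comm; sum-replicate-zero)
open import Data.Bool using (Bool; true; false; not; _∧_; _∨_; if_then_else_)
import Data.Bool.Properties as Bool
open import Data.Bool.Properties using (not-¬)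
open import Data.Fin using (Fin; zero; suc; splitAt; _↑ˡ_; _↑ʳ_)
open import Data.Fin.Properties using (_≟_; splitAt⁻¹-↑ˡ; splitAt⁻¹-↑ʳ; splitAt-↑ˡ; splitAt-↑ʳ)
open import Data.List using (length; filter; tabulate)
open import Data.Sum using (_⊎_; inj₁; inj₂; [_,_]′)
open import Data.Sum.Properties using ([,]-map; [,]-∘)
open import Data.Vec.Functional using (_++_; removeAt)
open import Data.Vec.Functional.Properties using (lookup-++ˡ; lookup-++ʳ)
open import Data.Empty using (⊥-elim)
open import Function using (_∘_; const)
open import Relation.Binary.PropositionalEquality as ≡ using (_≡_; _≢_; _≗_; refl; cong; cong₂; subst)
open import Relation.Nullary using (¬_; does; yes; no)
open import Relation.Nullary.Decidable using (dec-true; dec-false)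
open import Relation.Unary using (Pred; Decidable)
open import Level using (0ℓ)

∑-++ : ∀ {m n} (f : Fin m → ℕ) (g : Fin n → ℕ) → sum (f ++ g) ≡ sum f + sum g
∑-++ {zero} f g = refl
∑-++ {suc m} f g = ≡.trans
  (cong (f zero +_) (≡.trans (sum-cong-≗ (λ i → [,]-map (splitAt m i))) (∑-++ (f ∘ suc) g)))
  (≡.sym (+-assoc (f zero) _ _))

∑-∣ : ∀ {n d} (f : Fin n → ℕ) → (∀ i → d ∣ f i) → d ∣ sum f
∑-∣ {zero}  {d} f d∣f = d ∣0
∑-∣ {suc n}     f d∣f = ∣m∣n⇒∣m+n (d∣f zero) (∑-∣ (f ∘ suc) (d∣f ∘ suc))

∑-≤-* : ∀ {n} (f : Fin n → ℕ) {c} → (∀ i → f i ≤ c) → sum f ≤ n * c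
∑-≤-* {zero}  f f≤c = z≤n
∑-≤-* {suc n} f f≤c = +-mono-≤ (f≤c zero) (∑-≤-* (f ∘ suc) (f≤c ∘ suc))

*-≤-∑ : ∀ {n} (f : Fin n → ℕ) {c} → (∀ i → c ≤ f i) → n * c ≤ sum f
*-≤-∑ {zero}  f c≤f = z≤n
*-≤-∑ {suc n} f c≤f = +-mono-≤ (c≤f zero) (*-≤-∑ (f ∘ suc) (c≤f ∘ suc))

≤c∧n*c≤∑⇒≡c : ∀ {n} (f : Fin n → ℕ) {c} → (∀ i → f i ≤ c) → n * c ≤ sum f → ∀ i → f i ≡ c
≤c∧n*c≤∑⇒≡c {suc n} f {c} f≤c n*c≤∑ i =
  ≤-antisym (f≤c i) (+-cancelʳ-≤ (n * c) c (f i) (begin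
  c + n * c                  ≤⟨ n*c≤∑ ⟩
  sum f                      ≡⟨ sum-remove f ⟩
  f i + sum (removeAt f i)   ≤⟨ +-monoʳ-≤ (f i) (∑-≤-* (removeAt f i) (λ _ → f≤c _)) ⟩
  f i + n * c                ∎))
  where open ≤-Reasoning

c≤∧∑≤n*c⇒≡c : ∀ {n} (f : Fin n → ℕ) {c} → (∀ i → c ≤ f i) → sum f ≤ n * c → ∀ i → f i ≡ c
c≤∧∑≤n*c⇒≡c {suc n} f {c} c≤f ∑≤n*c i =
  ≤-antisym (+-cancelʳ-≤ (n * c) (f i) c (begin
  f i + n * c                ≤⟨ +-monoʳ-≤ (f i) (*-≤-∑ (removeAt f i) (λ _ → c≤f _)) ⟩
  f i + sum (removeAt f i)   ≡⟨ sum-remove f ⟨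
  sum f                      ≤⟨ ∑≤n*c ⟩
  c + n * c                  ∎)) (c≤f i)
  where open ≤-Reasoning

≤c∧n*c≤1+∑⇒f₀≡c∨f₁≡c : ∀ {n} (f : Fin (2 + n) → ℕ) {c} → (∀ i → f i ≤ c) →
  (2 + n) * c ≤ suc (sum f) → f zero ≡ c ⊎ f (suc zero) ≡ c
≤c∧n*c≤1+∑⇒f₀≡c∨f₁≡c {n} f {c} f≤c 2+n*c≤1+∑ with m≤n⇒m<n∨m≡n (f≤c zero)
... | inj₂ f₀≡c = inj₁ f₀≡c
... | inj₁ f₀<c = inj₂ (≤c∧n*c≤∑⇒≡c (f ∘ suc) (f≤c ∘ suc)
  (+-cancelˡ-≤ c _ _ (≤-trans 2+n*c≤1+∑ (+-monoˡ-≤ (sum (f ∘ suc)) f₀<c))) zero)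

indicator : Bool → ℕ
indicator b = if b then 1 else 0

count : ∀ {n} → (Fin n → Bool) → ℕ
count {n} b = ∑[ i < n ] indicator (b i)

count-cong : ∀ {n} {b b′ : Fin n → Bool} → b ≗ b′ → count b ≡ count b′
count-cong b≗b′ = sum-cong-≗ (cong indicator ∘ b≗b′)

count-++ : ∀ {m n} (b : Fin m → Bool) (b′ : Fin n → Bool) → count (b ++ b′) ≡ count b + count b′
count-++ {m} b b′ =
  ≡.trans (sum-cong-≗ (λ i → [,]-∘ indicator (splitAt m i))) (∑-++ (indicator ∘ b) (indicator ∘ b′))

count-false : ∀ n → count {n} (const false) ≡ 0
count-false n = sum-replicate-zero n

count-true : ∀ n → count {n} (const true) ≡ n
count-true zero    = refl
count-true (suc n) = cong suc (count-true n)

count-not : ∀ {n} (b : Fin n → Bool) → count (not ∘ b) + count b ≡ n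
count-not {n} b = begin
  count (not ∘ b) + count b              ≡⟨ ∑-distrib-+ (indicator ∘ not ∘ b) (indicator ∘ b) ⟨
  ∑[ i < n ] (indicator (not (b i)) + indicator (b i)) ≡⟨ sum-cong-≗ (complementary ∘ b) ⟩
  count {n} (const true)                 ≡⟨ count-true n ⟩
  n                                      ∎
  where
  open ≡.≡-Reasoning
  complementary : ∀ c → indicator (not c) + indicator c ≡ 1
  complementary true  = refl
  complementary false = refl

does-≟-sym : ∀ {n} (u v : Fin n) → does (u ≟ v) ≡ does (v ≟ u)
does-≟-sym u v with u ≟ v
... | yes refl = ≡.sym (dec-true (u ≟ u) refl)
... | no u≢v   = ≡.sym (dec-false (v ≟ u) (u≢v ∘ ≡.sym))

count-≟ : ∀ {n} (j : Fin n) → count (λ i → does (j ≟ i)) ≡ 1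
count-≟ {suc n} zero    = cong suc (count-false n)
count-≟ {suc n} (suc j) = count-≟ j

count-≟-∨ : ∀ {n} (b : Fin n → Bool) {j} → b j ≡ false →
  count (λ i → does (j ≟ i) ∨ b i) ≡ suc (count b)
count-≟-∨ {n} b {j} bj≡false = begin
  count (λ i → does (j ≟ i) ∨ b i)              ≡⟨ sum-cong-≗ split ⟩
  ∑[ i < n ] (indicator (does (j ≟ i)) + indicator (b i))
    ≡⟨ ∑-distrib-+ (λ i → indicator (does (j ≟ i))) (indicator ∘ b) ⟩
  count (λ i → does (j ≟ i)) + count b           ≡⟨ cong (_+ count b) (count-≟ j) ⟩
  suc (count b)                                 ∎
  where
  open ≡.≡-Reasoning
  split : ∀ i → indicator (does (j ≟ i) ∨ b i) ≡ indicator (does (j ≟ i)) + indicator (b i)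
  split i with j ≟ i
  ... | yes refl rewrite bj≡false = refl
  ... | no _ = refl

count-partition : ∀ {n x} (b : Fin n → Bool) (c : Fin n → Fin x) →
  count b ≡ ∑[ i < x ] count (λ w → b w ∧ does (c w ≟ i))
count-partition {n} {x} b c = ≡.trans (sum-cong-≗ split) (∑-comm (λ w i → indicator (b w ∧ does (c w ≟ i))))
  where
  split : ∀ w → indicator (b w) ≡ ∑[ i < x ] indicator (b w ∧ does (c w ≟ i))
  split w with b w
  ... | true  = ≡.sym (count-≟ (c w))
  ... | false = ≡.sym (count-false x)

length-filter-tabulate : ∀ {A : Set} {P : Pred A 0ℓ} (P? : Decidable P) {n} (f : Fin n → A) →
  length (filter P? (tabulate f)) ≡ count (λ i → does (P? (f i)))
length-filter-tabulate P? {zero} f = refl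
length-filter-tabulate P? {suc n} f with does (P? (f zero))
... | true  = cong suc (length-filter-tabulate P? (f ∘ suc))
... | false = length-filter-tabulate P? (f ∘ suc)

does-≟-true : ∀ b → does (b Bool.≟ true) ≡ b
does-≟-true true  = refl
does-≟-true false = refl

degree-count : ∀ {n} (G : Graph n) v → degree G v ≡ count (adj G v)
degree-count {n} G v = ≡.trans (length-filter-tabulate (λ w → adj G v w Bool.≟ true) {n} (λ w → w))
                               (count-cong (does-≟-true ∘ adj G v))

odd⇒¬2∣ : ∀ {n} → Odd n → ¬ 2 ∣ n
odd⇒¬2∣ (k , refl) 2∣2k+1 with ∣1⇒≡1 (∣m+n∣m⇒∣n 2∣2k+1 (m∣m*n k))
... | ()

odd+odd : ∀ {m n} → Odd m → Odd n → 2 ∣ m + n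
odd+odd (k , refl) (l , refl) = divides (suc (k + l)) (sum-of-odds k l)
  where
  sum-of-odds : ∀ k l → 2 * k + 1 + (2 * l + 1) ≡ suc (k + l) * 2
  sum-of-odds = solve-∀

odd*odd : ∀ {m n} → Odd m → Odd n → Odd (m * n)
odd*odd (k , refl) (l , refl) = 2 * k * l + k + l , product-of-odds k l
  where
  product-of-odds : ∀ k l → (2 * k + 1) * (2 * l + 1) ≡ 2 * (2 * k * l + k + l) + 1
  product-of-odds = solve-∀

even+1 : ∀ {n} → 2 ∣ n → Odd (n + 1)
even+1 (divides q refl) = q , cong (_+ 1) (*-comm q 2)

odd+2 : ∀ {n} → Odd n → Odd (n + 2)
odd+2 (k , refl) = suc k , shift k
  where
  shift : ∀ k → 2 * k + 1 + 2 ≡ 2 * suc k + 1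
  shift = solve-∀

even-or-odd : ∀ n → 2 ∣ n ⊎ Odd n
even-or-odd zero = inj₁ (2 ∣0)
even-or-odd (suc n) with even-or-odd n
... | inj₁ 2∣n   = inj₂ (subst Odd (+-comm n 1) (even+1 2∣n))
... | inj₂ n-odd = inj₁ (subst (2 ∣_) (+-comm n 1) (odd+odd n-odd (0 , refl)))

odd⇒3+J*2 : ∀ {n} → Odd n → 2 ≤ n → Σ ℕ λ J → n ≡ 3 + J * 2
odd⇒3+J*2 (zero  , refl) (s≤s ())
odd⇒3+J*2 (suc J , refl) _ = J , shift J
  where
  shift : ∀ J → 2 * suc J + 1 ≡ 3 + J * 2
  shift = solve-∀

∑-count-symmetric : ∀ {n} (R : Fin n → Fin n → Bool) →
  (∀ u v → R u v ≡ R v u) → (∀ v → R v v ≡ false) → 2 ∣ ∑[ u < n ] count (R u)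
∑-count-symmetric {zero}  R R-sym R-irrefl = 2 ∣0
∑-count-symmetric {suc n} R R-sym R-irrefl =
  -- By symmetry, row 0 and column 0 of R contribute the same count X.
  subst (2 ∣_) (≡.sym total) (∣m∣n⇒∣m+n (m∣m*n X) inner-even)
  where
  X : ℕ
  X = count (R zero ∘ suc)
  Inner : ℕ
  Inner = ∑[ u < n ] count (λ w → R (suc u) (suc w))
  inner-even : 2 ∣ Inner
  inner-even =
    ∑-count-symmetric (λ u w → R (suc u) (suc w)) (λ u w → R-sym (suc u) (suc w)) (R-irrefl ∘ suc)
  column : ∑[ u < n ] indicator (R (suc u) zero) ≡ X
  column = sum-cong-≗ (λ u → cong indicator (R-sym (suc u) zero))
  total : ∑[ u < suc n ] count (R u) ≡ 2 * X + Inner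
  total rewrite R-irrefl zero
              | ∑-distrib-+ (λ u → indicator (R (suc u) zero)) (λ u → count (λ w → R (suc u) (suc w)))
              | column = twice X Inner
    where
    twice : ∀ m n → m + (m + n) ≡ 2 * m + n
    twice = solve-∀

handshake : ∀ {n} (G : Graph n) → 2 ∣ ∑[ v < n ] degree G v
handshake G =
  subst (2 ∣_) (≡.sym (sum-cong-≗ (degree-count G))) (∑-count-symmetric (adj G) (sym G) (irrefl G))

factor : ∀ {n x} {G : Graph n} → Decomposition G x → Fin x → Graph n
factor {G = G} D i = record
  { adj    = λ u v → adj G u v ∧ does (col D u v ≟ i)
  ; sym    = factor-sym
  ; irrefl = λ v → cong (_∧ _) (irrefl G v)
  }
  where
  factor-sym : ∀ u v → adj G u v ∧ does (col D u v ≟ i) ≡ adj G v u ∧ does (col D v u ≟ i)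
  factor-sym u v rewrite sym G u v with adj G v u in e
  ... | false = refl
  ... | true  = cong (λ c → does (c ≟ i)) (col-sym D u v (≡.trans (sym G u v) e))

factorDegree-factor : ∀ {n x} {G : Graph n} (D : Decomposition G x) i v →
  factorDegree D i v ≡ degree (factor D i) v
factorDegree-factor {n} {G = G} D i v = begin
  factorDegree D i v                            ≡⟨ length-filter-tabulate _ {n} (λ w → w) ⟩
  count (λ w → does (adj G v w Bool.≟ true) ∧ does (col D v w ≟ i))
    ≡⟨ count-cong (λ w → cong (_∧ _) (does-≟-true (adj G v w))) ⟩
  count (adj (factor D i) v)                    ≡⟨ degree-count (factor D i) v ⟨
  degree (factor D i) v                         ∎
  where open ≡.≡-Reasoning

degree-∑-factor : ∀ {n x} {G : Graph n} (D : Decomposition G x) v →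
  degree G v ≡ ∑[ i < x ] degree (factor D i) v
degree-∑-factor {G = G} D v = begin
  degree G v                                   ≡⟨ degree-count G v ⟩
  count (adj G v)                              ≡⟨ count-partition (adj G v) (col D v) ⟩
  ∑[ i < _ ] count (adj (factor D i) v)        ≡⟨ sum-cong-≗ (λ i → degree-count (factor D i) v) ⟨
  ∑[ i < _ ] degree (factor D i) v             ∎
  where open ≡.≡-Reasoning

record Obstruction {n} (G : Graph n) (d c : ℕ) : Set where
  field
    side          : Fin n → Bool
    side-odd      : Odd (count side)
    defect        : Fin n
    degree-side   : ∀ v → side v ≡ true → degree G v ≡ d
    degree-rest   : ∀ v → side v ≡ false → v ≢ defect → degree G v ≡ c
    degree-defect-≤ : degree G defect ≤ c
    degree-defect-≥ : c ≤ suc (degree G defect)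

obstruction⇒¬factorization : ∀ {n} {G : Graph n} {r a x} → Odd r → 2 ∣ r + a → 2 ≤ x →
  Obstruction G (x * r) (x * (r + a)) → ¬ HasFactorization G r a x
obstruction⇒¬factorization {n} {G} {r} {a} {x@(suc (suc _))} r-odd r+a-even (s≤s (s≤s _)) O
                           (D , isFactorization) =
  odd⇒¬2∣ side-odd (∣m+n∣m⇒∣n (subst (2 ∣_) (∑-distrib-+ g (indicator ∘ side)) (∑-∣ _ g+side-even))
                                (subst (2 ∣_) (sum-cong-≗ forced) (handshake (factor D i₀))))
  where
  open Obstruction O
  f : Fin x → Fin n → ℕ
  f i v = degree (factor D i) v
  r≤f : ∀ v i → r ≤ f i v
  r≤f v i = subst (r ≤_) (factorDegree-factor D i v) (proj₁ (isFactorization i v))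
  f≤r+a : ∀ v i → f i v ≤ r + a
  f≤r+a v i = subst (_≤ r + a) (factorDegree-factor D i v) (proj₂ (isFactorization i v))
  ∑f≡ : ∀ {v k} → degree G v ≡ k → sum (λ i → f i v) ≡ k
  ∑f≡ {v} = ≡.trans (≡.sym (degree-∑-factor D v))
  chosen : Σ (Fin x) λ i → f i defect ≡ r + a
  chosen with ≤c∧n*c≤1+∑⇒f₀≡c∨f₁≡c (λ i → f i defect) (f≤r+a defect)
                (≤-trans degree-defect-≥ (≤-reflexive (cong suc (degree-∑-factor D defect))))
  ... | inj₁ e = zero , e
  ... | inj₂ e = suc zero , e
  i₀ : Fin x
  i₀ = proj₁ chosen
  g : Fin n → ℕ
  g v = if side v then r else r + a
  forced : ∀ v → f i₀ v ≡ g v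
  forced v with side v in s | v ≟ defect
  ... | true  | _          = c≤∧∑≤n*c⇒≡c (λ i → f i v) (r≤f v) (≤-reflexive (∑f≡ (degree-side v s))) i₀
  ... | false | yes refl   = proj₂ chosen
  ... | false | no v≢defect =
    ≤c∧n*c≤∑⇒≡c (λ i → f i v) (f≤r+a v) (≤-reflexive (≡.sym (∑f≡ (degree-rest v s v≢defect)))) i₀
  g+side-even : ∀ v → 2 ∣ g v + indicator (side v)
  g+side-even v with side v
  ... | true  = odd+odd r-odd (0 , refl)
  ... | false = subst (2 ∣_) (≡.sym (+-identityʳ (r + a))) r+a-even

obstruction⇒dds : ∀ {n} {G : Graph n} {d s} → 0 < s → Obstruction G d (d + s) → IsDDSGraph G d s
obstruction⇒dds {G = G} {d} {s} 0<s O = bounds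
  where
  open Obstruction O
  bounds : ∀ v → d ≤ degree G v × degree G v ≤ d + s
  bounds v with side v in sv | v ≟ defect
  ... | true  | _ = ≤-reflexive (≡.sym deg≡d) , ≤-trans (≤-reflexive deg≡d) (m≤m+n d s)
    where deg≡d = degree-side v sv
  ... | false | yes refl =
    ≤-pred (≤-trans (≤-reflexive (+-comm 1 d)) (≤-trans (+-monoʳ-≤ d 0<s) degree-defect-≥)) , degree-defect-≤
  ... | false | no v≢defect = ≤-trans (m≤m+n d s) (≤-reflexive (≡.sym deg≡c)) , ≤-reflexive deg≡c
    where deg≡c = degree-rest v sv v≢defect

emptyGraph : ∀ n → Graph n
emptyGraph n = record { adj = λ _ _ → false ; sym = λ _ _ → refl ; irrefl = λ _ → refl }

degree-emptyGraph : ∀ {n} (v : Fin n) → degree (emptyGraph n) v ≡ 0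
degree-emptyGraph {n} v = ≡.trans (degree-count (emptyGraph n) v) (count-false n)

complement : ∀ {n} → Graph n → Graph n
complement G = record
  { adj    = λ u v → not (does (u ≟ v) ∨ adj G u v)
  ; sym    = λ u v → cong not (cong₂ _∨_ (does-≟-sym u v) (sym G u v))
  ; irrefl = λ v → cong (λ b → not (b ∨ adj G v v)) (dec-true (v ≟ v) refl)
  }

degree-complement : ∀ {n} (G : Graph n) v → degree (complement G) v + suc (degree G v) ≡ n
degree-complement {n} G v = begin
  degree (complement G) v + suc (degree G v)
    ≡⟨ cong₂ _+_ (degree-count (complement G) v) (cong suc (degree-count G v)) ⟩
  count (not ∘ closedRow) + suc (count (adj G v))
    ≡⟨ cong (count (not ∘ closedRow) +_) (count-≟-∨ (adj G v) (irrefl G v)) ⟨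
  count (not ∘ closedRow) + count closedRow
    ≡⟨ count-not closedRow ⟩
  n ∎
  where
  open ≡.≡-Reasoning
  closedRow : Fin n → Bool
  closedRow w = does (v ≟ w) ∨ adj G v w

complete : ∀ n → Graph n
complete n = complement (emptyGraph n)

blocks : ∀ {m n} → Bool → (Fin m → Fin m → Bool) → (Fin n → Fin n → Bool) →
  Fin m ⊎ Fin n → Fin m ⊎ Fin n → Bool
blocks c A B (inj₁ u) (inj₁ v) = A u v
blocks c A B (inj₂ u) (inj₂ v) = B u v
blocks c A B _        _        = c

blocks-sym : ∀ {m n} c {A : Fin m → Fin m → Bool} {B : Fin n → Fin n → Bool} →
  (∀ u v → A u v ≡ A v u) → (∀ u v → B u v ≡ B v u) → ∀ s t → blocks c A B s t ≡ blocks c A B t s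
blocks-sym c A-sym B-sym (inj₁ u) (inj₁ v) = A-sym u v
blocks-sym c A-sym B-sym (inj₁ u) (inj₂ v) = refl
blocks-sym c A-sym B-sym (inj₂ u) (inj₁ v) = refl
blocks-sym c A-sym B-sym (inj₂ u) (inj₂ v) = B-sym u v

blocks-irrefl : ∀ {m n} c {A : Fin m → Fin m → Bool} {B : Fin n → Fin n → Bool} →
  (∀ v → A v v ≡ false) → (∀ v → B v v ≡ false) → ∀ s → blocks c A B s s ≡ false
blocks-irrefl c A-irrefl B-irrefl (inj₁ v) = A-irrefl v
blocks-irrefl c A-irrefl B-irrefl (inj₂ v) = B-irrefl v

blocks-rowˡ : ∀ {m n} c (A : Fin m → Fin m → Bool) (B : Fin n → Fin n → Bool) u t →
  blocks c A B (inj₁ u) t ≡ [ A u , const c ]′ t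
blocks-rowˡ c A B u (inj₁ _) = refl
blocks-rowˡ c A B u (inj₂ _) = refl

blocks-rowʳ : ∀ {m n} c (A : Fin m → Fin m → Bool) (B : Fin n → Fin n → Bool) w t →
  blocks c A B (inj₂ w) t ≡ [ const c , B w ]′ t
blocks-rowʳ c A B w (inj₁ _) = refl
blocks-rowʳ c A B w (inj₂ _) = refl

glue : ∀ {m n} → Bool → Graph m → Graph n → Graph (m + n)
glue {m} c G H = record
  { adj    = λ u v → blocks c (adj G) (adj H) (splitAt m u) (splitAt m v)
  ; sym    = λ u v → blocks-sym c (sym G) (sym H) (splitAt m u) (splitAt m v)
  ; irrefl = λ v → blocks-irrefl c (irrefl G) (irrefl H) (splitAt m v)
  }

degree-glueˡ : ∀ {m n} c (G : Graph m) (H : Graph n) u →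
  degree (glue c G H) (u ↑ˡ n) ≡ degree G u + count {n} (const c)
degree-glueˡ {m} {n} c G H u = begin
  degree (glue c G H) (u ↑ˡ n)  ≡⟨ degree-count (glue c G H) (u ↑ˡ n) ⟩
  count (λ w → blocks c (adj G) (adj H) (splitAt m (u ↑ˡ n)) (splitAt m w))
    ≡⟨ count-cong (λ w → ≡.trans (cong (λ s → blocks c (adj G) (adj H) s (splitAt m w)) (splitAt-↑ˡ m u n))
                                   (blocks-rowˡ c (adj G) (adj H) u (splitAt m w))) ⟩
  count (adj G u ++ const {B = Fin n} c) ≡⟨ count-++ (adj G u) (const c) ⟩
  count (adj G u) + count {n} (const c) ≡⟨ cong (_+ _) (degree-count G u) ⟨
  degree G u + count {n} (const c) ∎
  where open ≡.≡-Reasoning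

degree-glueʳ : ∀ {m n} c (G : Graph m) (H : Graph n) w →
  degree (glue c G H) (m ↑ʳ w) ≡ count {m} (const c) + degree H w
degree-glueʳ {m} {n} c G H w = begin
  degree (glue c G H) (m ↑ʳ w)  ≡⟨ degree-count (glue c G H) (m ↑ʳ w) ⟩
  count (λ v → blocks c (adj G) (adj H) (splitAt m (m ↑ʳ w)) (splitAt m v))
    ≡⟨ count-cong (λ v → ≡.trans (cong (λ s → blocks c (adj G) (adj H) s (splitAt m v)) (splitAt-↑ʳ m n w))
                                   (blocks-rowʳ c (adj G) (adj H) w (splitAt m v))) ⟩
  count (const {B = Fin m} c ++ adj H w) ≡⟨ count-++ {m} (const c) (adj H w) ⟩
  count {m} (const c) + count (adj H w) ≡⟨ cong (_ +_) (degree-count H w) ⟨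
  count {m} (const c) + degree H w ∎
  where open ≡.≡-Reasoning

infixr 6 _⊕_

_⊕_ : ∀ {m n} → Graph m → Graph n → Graph (m + n)
_⊕_ = glue false

join : ∀ {m n} → Graph m → Graph n → Graph (m + n)
join = glue true

degree-⊕ˡ : ∀ {m n} (G : Graph m) (H : Graph n) u → degree (G ⊕ H) (u ↑ˡ n) ≡ degree G u
degree-⊕ˡ {n = n} G H u =
  ≡.trans (degree-glueˡ false G H u) (≡.trans (cong (degree G u +_) (count-false n)) (+-identityʳ _))

degree-⊕ʳ : ∀ {m n} (G : Graph m) (H : Graph n) w → degree (G ⊕ H) (m ↑ʳ w) ≡ degree H w
degree-⊕ʳ {m} G H w = ≡.trans (degree-glueʳ false G H w) (cong (_+ degree H w) (count-false m))

degree-joinˡ : ∀ {m n} (G : Graph m) (H : Graph n) u → degree (join G H) (u ↑ˡ n) ≡ degree G u + n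
degree-joinˡ {n = n} G H u = ≡.trans (degree-glueˡ true G H u) (cong (degree G u +_) (count-true n))

degree-joinʳ : ∀ {m n} (G : Graph m) (H : Graph n) w → degree (join G H) (m ↑ʳ w) ≡ m + degree H w
degree-joinʳ {m} G H w = ≡.trans (degree-glueʳ true G H w) (cong (_+ degree H w) (count-true m))

↑-elim : ∀ {m n} (P : Fin (m + n) → Set) → (∀ u → P (u ↑ˡ n)) → (∀ w → P (m ↑ʳ w)) → ∀ v → P v
↑-elim {m} P left right v with splitAt m v in eq
... | inj₁ u = subst P (splitAt⁻¹-↑ˡ eq) (left u)
... | inj₂ w = subst P (splitAt⁻¹-↑ʳ eq) (right w)

cherry : Graph 3
cherry = join (emptyGraph 1) (emptyGraph 2)

matching : ∀ J → Graph (J * 2)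
matching zero    = emptyGraph 0
matching (suc J) = complete 2 ⊕ matching J

degree-complete-2 : ∀ v → degree (complete 2) v ≡ 1
degree-complete-2 zero       = refl
degree-complete-2 (suc zero) = refl

degree-matching : ∀ J v → degree (matching J) v ≡ 1
degree-matching (suc J) = ↑-elim (λ v → degree (matching (suc J)) v ≡ 1)
  (λ u → ≡.trans (degree-⊕ˡ (complete 2) (matching J) u) (degree-complete-2 u))
  (λ w → ≡.trans (degree-⊕ʳ (complete 2) (matching J) w) (degree-matching J w))

degree-cherry-leaf : ∀ u → u ≢ zero → degree cherry u ≡ 1
degree-cherry-leaf zero             0≢0 = ⊥-elim (0≢0 refl)
degree-cherry-leaf (suc zero)       _   = refl
degree-cherry-leaf (suc (suc zero)) _   = refl

degree-cherry⊕matching : ∀ J u → u ≢ zero → degree (cherry ⊕ matching J) u ≡ 1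
degree-cherry⊕matching J = ↑-elim (λ u → u ≢ zero → degree (cherry ⊕ matching J) u ≡ 1)
  (λ u u≢0 → ≡.trans (degree-⊕ˡ cherry (matching J) u) (degree-cherry-leaf u (u≢0 ∘ cong (_↑ˡ J * 2))))
  (λ w _ → ≡.trans (degree-⊕ʳ cherry (matching J) w) (degree-matching J w))

-- A vertex of H of degree h has degree (m − 1 − h) + p in the join, which is c by the hypothesis
-- m + p ≡ c + suc h.
join-complement-obstruction : ∀ {m p h c} (H : Graph m) (v₀ : Fin m) → Odd p → m + p ≡ c + suc h →
  (∀ u → u ≢ v₀ → degree H u ≡ h) → h ≤ degree H v₀ → degree H v₀ ≤ suc h →
  Obstruction (join (complement H) (emptyGraph p)) m c
join-complement-obstruction {m} {p} {h} {c} H v₀ p-odd m+p≡c+1+h regular h≤deg₀ deg₀≤1+h = record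
  { side          = side
  ; side-odd      = subst Odd (≡.sym count-side) p-odd
  ; defect        = v₀ ↑ˡ p
  ; degree-side   = ↑-elim (λ v → side v ≡ true → degree G v ≡ m)
      (λ u s → ⊥-elim (not-¬ (side-left u) s))
      (λ w _ → ≡.trans (degree-joinʳ (complement H) (emptyGraph p) w)
                       (≡.trans (cong (m +_) (degree-emptyGraph w)) (+-identityʳ m)))
  ; degree-rest   = ↑-elim (λ v → side v ≡ false → v ≢ v₀ ↑ˡ p → degree G v ≡ c)
      (λ u _ u≢v₀ → +-cancelʳ-≡ (suc h) _ _
          (subst (λ k → degree G (u ↑ˡ p) + suc k ≡ c + suc h) (regular u (u≢v₀ ∘ cong (_↑ˡ p))) (row u)))
      (λ w s → ⊥-elim (not-¬ (side-right w) s))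
  ; degree-defect-≤ =
      +-cancelʳ-≤ (suc h) deg₀ c (≤-trans (+-monoʳ-≤ deg₀ (s≤s h≤deg₀)) (≤-reflexive (row v₀)))
  ; degree-defect-≥ = +-cancelʳ-≤ (suc h) c (suc deg₀) c+1+h≤1+deg₀+1+h
  }
  where
  G : Graph (m + p)
  G = join (complement H) (emptyGraph p)
  deg₀ : ℕ
  deg₀ = degree G (v₀ ↑ˡ p)
  side : Fin (m + p) → Bool
  side = const {B = Fin m} false ++ const true
  side-left : ∀ u → side (u ↑ˡ p) ≡ false
  side-left = lookup-++ˡ {m = m} (const false) (const true)
  side-right : ∀ w → side (m ↑ʳ w) ≡ true
  side-right = lookup-++ʳ {m = m} (const false) (const true)
  count-side : count side ≡ p
  count-side = ≡.trans (count-++ {m} (const false) (const true)) (cong₂ _+_ (count-false m) (count-true p))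
  row : ∀ u → degree G (u ↑ˡ p) + suc (degree H u) ≡ c + suc h
  row u = begin
    degree G (u ↑ˡ p) + suc (degree H u)
      ≡⟨ cong (_+ suc (degree H u)) (degree-joinˡ (complement H) (emptyGraph p) u) ⟩
    degree (complement H) u + p + suc (degree H u)  ≡⟨ swap (degree (complement H) u) p (degree H u) ⟩
    degree (complement H) u + suc (degree H u) + p  ≡⟨ cong (_+ p) (degree-complement H u) ⟩
    m + p                                           ≡⟨ m+p≡c+1+h ⟩
    c + suc h                                       ∎
    where
    open ≡.≡-Reasoning
    swap : ∀ x y z → x + y + suc z ≡ x + suc z + y
    swap = solve-∀
  c+1+h≤1+deg₀+1+h : c + suc h ≤ suc deg₀ + suc h
  c+1+h≤1+deg₀+1+h = begin
    c + suc h                      ≡⟨ row v₀ ⟨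
    deg₀ + suc (degree H v₀)       ≤⟨ +-monoʳ-≤ deg₀ (s≤s deg₀≤1+h) ⟩
    deg₀ + suc (suc h)             ≡⟨ +-suc deg₀ (suc h) ⟩
    suc deg₀ + suc h               ∎
    where open ≤-Reasoning

obstruction-even : ∀ {d e} → 0 < d → 2 ∣ e → Obstruction (join (complete d) (emptyGraph (e + 1))) d (d + e)
obstruction-even {d} {e} (s≤s z≤n) 2∣e =
  join-complement-obstruction (emptyGraph d) zero (even+1 2∣e) (≡.sym (+-assoc d e 1))
    (λ u _ → degree-emptyGraph u) z≤n (≤-trans (≤-reflexive (degree-emptyGraph {d} zero)) z≤n)

obstruction-odd : ∀ J {e} → Odd e →
  Obstruction (join (complement (cherry ⊕ matching J)) (emptyGraph (e + 2))) (3 + J * 2) (3 + J * 2 + e)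
obstruction-odd J {e} e-odd =
  join-complement-obstruction (cherry ⊕ matching J) zero (odd+2 e-odd) (≡.sym (+-assoc (3 + J * 2) e 2))
    (degree-cherry⊕matching J) (subst (1 ≤_) (≡.sym deg₀≡2) (s≤s z≤n)) (≤-reflexive deg₀≡2)
  where
  deg₀≡2 : degree (cherry ⊕ matching J) zero ≡ 2
  deg₀≡2 = degree-⊕ˡ cherry (matching J) zero

obstruction-exists : ∀ {r a x} → Odd r → Odd a → 0 < r → 2 ≤ x →
  Σ ℕ λ n → Σ (Graph n) λ G → Obstruction G (x * r) (x * r + x * a)
obstruction-exists {r} {a} {x} r-odd a-odd 0<r 2≤x with even-or-odd x
... | inj₁ 2∣x = _ , _ , obstruction-even (*-mono-≤ (≤-trans (s≤s z≤n) 2≤x) 0<r) (∣m⇒∣m*n a 2∣x)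
... | inj₂ x-odd with odd⇒3+J*2 (odd*odd x-odd r-odd) (*-mono-≤ 2≤x 0<r)
...   | J , x*r≡3+J*2 = _ , G ,
  subst (λ d → Obstruction G d (d + x * a)) (≡.sym x*r≡3+J*2) (obstruction-odd J (odd*odd x-odd a-odd))
  where
  G : Graph (3 + J * 2 + (x * a + 2))
  G = join (complement (cherry ⊕ matching J)) (emptyGraph (x * a + 2))

theorem31 : (r a d s x : ℕ) → Odd r → Odd a → 0 < r → 3 ≤ a →
    0 < d → 0 < s → 0 < x → d + s ≡ x * (r + a) → d ≡ x * r → 2 ≤ x →
    Σ ℕ (λ n → Σ (Graph n) (λ G → IsDDSGraph G d s × ¬ HasFactorization G r a x))
theorem31 r a d s x r-odd a-odd 0<r _ _ 0<s _ d+s≡x*[r+a] refl 2≤x with obstruction-exists r-odd a-odd 0<r 2≤x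
... | n , G , O = n , G ,
  obstruction⇒dds 0<s (subst (Obstruction G d) (≡.trans x*r+x*a≡x*[r+a] (≡.sym d+s≡x*[r+a])) O) ,
  obstruction⇒¬factorization r-odd (odd+odd r-odd a-odd) 2≤x (subst (Obstruction G d) x*r+x*a≡x*[r+a] O)
  where
  x*r+x*a≡x*[r+a] : x * r + x * a ≡ x * (r + a)
  x*r+x*a≡x*[r+a] = ≡.sym (*-distribˡ-+ x r a)
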